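{- Let $n$ be even and $F\colon\mathbb F_2^n\to\mathbb F_2^n$ a plateaued APN function. Then it is not the case that $F$ has the following value distribution: $|\mathrm{Im}(F)|=\frac{2^n+2}{3}$, exactly two elements of $\mathrm{Im}(F)$ have preimage sets of size $2$, and all other $\frac{2^n-4}{3}$ elements of $\mathrm{Im}(F)$ have preimage sets of size $3$.
   Context: Scalar product $\langle x,y\rangle=\sum x_iy_i$; components $F_b(x)=\langle b,F(x)\rangle$; $W_f(a)=\sum_x(-1)^{f(x)+\langle a,x\rangle}$. $f$ is $t$-plateaued if $|W_f(a)|\in\{0,2^{(n+t)/2}\}$ for all $a$. $F$ is plateaued if each $F_b$, $b\ne0$, is $s_b$-plateaued for some $s_b$. $F$ is APN if for all $a\ne0$ and all $b$ the equation $F(x+a)+F(x)=b$ has at most $2$ solutions. $\mathrm{Im}(F)$ is the image set. -}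

module Defs where

open import Data.Bool using (Bool; true; false; _xor_; _∧_; if_then_else_)
import Data.Bool.Properties as BoolP
open import Data.Nat using (ℕ; zero; suc; _+_; _*_; _^_; _≤_; _<_; _%_; _/_)
open import Data.Integer as ℤ using (ℤ; +_; -[1+_]; ∣_∣)
open import Data.List using (List; []; _∷_; map; concatMap; filter; length; foldr)
open import Data.Vec using (Vec; []; _∷_; zipWith; replicate)
open import Data.Vec.Properties using (≡-dec)
open import Data.Product using (_×_; ∃)
open import Data.Sum using (_⊎_)
open import Relation.Binary.PropositionalEquality using (_≡_)
open import Relation.Nullary using (¬_)
import Data.Nat.Properties as ℕP

-- F_2^n is modelled as Vec Bool n (false = 0, true = 1)
𝔽₂^ : ℕ → Set
𝔽₂^ n = Vec Bool n

allVecs : (n : ℕ) → List (𝔽₂^ n)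
allVecs zero = [] ∷ []
allVecs (suc n) = concatMap (λ v → (false ∷ v) ∷ (true ∷ v) ∷ []) (allVecs n)

_≟ᵥ_ : ∀ {n} (u v : 𝔽₂^ n) → Relation.Nullary.Dec (u ≡ v)
_≟ᵥ_ = ≡-dec BoolP._≟_

_⊕_ : ∀ {n} → 𝔽₂^ n → 𝔽₂^ n → 𝔽₂^ n
_⊕_ = zipWith _xor_

0ᵥ : ∀ {n} → 𝔽₂^ n
0ᵥ = replicate _ false

⟨_,_⟩ : ∀ {n} → 𝔽₂^ n → 𝔽₂^ n → Bool
⟨ [] , [] ⟩ = false
⟨ x ∷ xs , y ∷ ys ⟩ = (x ∧ y) xor ⟨ xs , ys ⟩

sign : Bool → ℤ
sign false = + 1
sign true  = -[1+ 0 ]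

walsh : ∀ {n} → (𝔽₂^ n → Bool) → 𝔽₂^ n → ℤ
walsh {n} f a = foldr ℤ._+_ (+ 0) (map (λ x → sign (f x xor ⟨ a , x ⟩)) (allVecs n))

-- f is t-plateaued: |W_f(a)| ∈ {0, 2^((n+t)/2)} for all a.
-- (2^((n+t)/2) is an integer only when n+t is even; we require that in the nonzero case.)
IsPlateaued : (n t : ℕ) → (𝔽₂^ n → Bool) → Set
IsPlateaued n t f =
  ∀ a → ∣ walsh f a ∣ ≡ 0 ⊎ ((n + t) % 2 ≡ 0 × ∣ walsh f a ∣ ≡ 2 ^ ((n + t) / 2))

component : ∀ {n} → (𝔽₂^ n → 𝔽₂^ n) → 𝔽₂^ n → 𝔽₂^ n → Bool
component F b x = ⟨ b , F x ⟩

IsPlateauedFn : (n : ℕ) → (𝔽₂^ n → 𝔽₂^ n) → Set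
IsPlateauedFn n F = ∀ (b : 𝔽₂^ n) → ¬ b ≡ 0ᵥ → ∃ λ s → IsPlateaued n s (component F b)

derivCount : ∀ {n} → (𝔽₂^ n → 𝔽₂^ n) → 𝔽₂^ n → 𝔽₂^ n → ℕ
derivCount {n} F a b = length (filter (λ x → (F (x ⊕ a) ⊕ F x) ≟ᵥ b) (allVecs n))

IsAPN : (n : ℕ) → (𝔽₂^ n → 𝔽₂^ n) → Set
IsAPN n F = ∀ (a b : 𝔽₂^ n) → ¬ a ≡ 0ᵥ → derivCount F a b ≤ 2

preimageSize : ∀ {n} → (𝔽₂^ n → 𝔽₂^ n) → 𝔽₂^ n → ℕ
preimageSize {n} F y = length (filter (λ x → F x ≟ᵥ y) (allVecs n))

image : ∀ {n} → (𝔽₂^ n → 𝔽₂^ n) → List (𝔽₂^ n)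
image {n} F = filter (λ y → 1 ℕP.≤? preimageSize F y) (allVecs n)

HasDistribution : (n : ℕ) → (𝔽₂^ n → 𝔽₂^ n) → Set
HasDistribution n F =
  (3 * length (image F) ≡ 2 ^ n + 2)
  × (length (filter (λ y → preimageSize F y ℕP.≟ 2) (image F)) ≡ 2)
  × (∀ y → 1 ≤ preimageSize F y → ¬ preimageSize F y ≡ 2 → preimageSize F y ≡ 3)

module Submission where

open import Defs
open import Data.Bool using (Bool; true; false; _xor_; _∧_; not)
open import Data.Bool.Properties using (xor-comm; xor-same; xor-identityʳ; ∧-comm; ∧-distribˡ-xor)
open import Data.Nat as ℕ using (ℕ; zero; suc; _%_)
import Data.Nat.Properties as ℕP
open import Data.Integer as ℤ using (ℤ; +_; -[1+_]; _+_; _*_; -_; _-_; _≤_; _<_; _^_; -1ℤ)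
import Data.Integer.Properties as ℤP
open import Data.Integer.Tactic.RingSolver using (solve-∀)
open import Data.List using (List; []; _∷_; map; concatMap; filter; length; foldr)
open import Data.Vec using ([]; _∷_)
open import Data.Vec.Properties using (∷-injectiveˡ; ∷-injectiveʳ)
open import Data.Nat.Divisibility using (divides; m%n≡0⇒n∣m)
open import Data.Product using (∃; _,_)
open import Data.Sum using (_⊎_; inj₁; inj₂)
open import Data.Empty using (⊥-elim)
open import Relation.Nullary using (¬_; Dec; yes; no)
open import Relation.Binary.PropositionalEquality
open import Function using (_∘_)
open import Algebra.Properties.CommutativeSemigroup ℤP.+-commutativeSemigroup
  using () renaming (interchange to +-interchange)
open import Algebra.Properties.CommutativeSemigroup ℤP.*-commutativeSemigroup
  using () renaming (interchange to *-interchange)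

-- For w : 𝔽₂ⁿ → ℤ let excess w = Σₐ w(a)⁴ − 2²ⁿ w(0)². For the Walsh transforms W_b of the
-- components of F, Σ_{a,b} W_b(a)⁴ = 2²ⁿ Σᵤ #{(x,z) : D_u F(x) = D_u F(z)} and
-- Σ_b W_b(0)² = 2ⁿ #{(x,z) : F(x) = F(z)}. The APN property evaluates the first count to
-- 2²ⁿ + (2ⁿ − 1)·2ⁿ⁺¹, the value distribution the second to 3·2ⁿ − 4, so Σ_b excess W_b = 2·2³ⁿ.
-- On the other hand, a plateaued W_b has W_b(a)² ∈ {0, 2²ᵐ}, and Parseval gives
-- excess W_b = (2²ᵐ − W_b(0)²)·2²ⁿ. This vanishes unless W_b(0) = 0, in which case Parseval forces
-- 2²ᵐ > 2ⁿ, hence 2²ᵐ ≥ 4·2ⁿ because n is even, and excess W_b ≥ 4·2³ⁿ. A sum of terms that are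
-- each 0 or at least 4·2³ⁿ cannot equal 2·2³ⁿ.

∑ : (n : ℕ) → (𝔽₂^ n → ℤ) → ℤ
∑ zero    g = g []
∑ (suc n) g = ∑ n (λ v → g (false ∷ v)) + ∑ n (λ v → g (true ∷ v))

∑-cong : ∀ {n} {g h : 𝔽₂^ n → ℤ} → (∀ v → g v ≡ h v) → ∑ n g ≡ ∑ n h
∑-cong {zero}  g≡h = g≡h []
∑-cong {suc n} g≡h = cong₂ _+_ (∑-cong (λ v → g≡h (false ∷ v))) (∑-cong (λ v → g≡h (true ∷ v)))

∑-vanish : ∀ {n} {g : 𝔽₂^ n → ℤ} → (∀ v → g v ≡ + 0) → ∑ n g ≡ + 0
∑-vanish {zero}  g≡0 = g≡0 []
∑-vanish {suc n} g≡0 = cong₂ _+_ (∑-vanish (λ v → g≡0 (false ∷ v))) (∑-vanish (λ v → g≡0 (true ∷ v)))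

∑-+ : ∀ {n} (g h : 𝔽₂^ n → ℤ) → ∑ n (λ v → g v + h v) ≡ ∑ n g + ∑ n h
∑-+ {zero}  g h = refl
∑-+ {suc n} g h =
  trans (cong₂ _+_ (∑-+ (λ v → g (false ∷ v)) (λ v → h (false ∷ v))) (∑-+ (λ v → g (true ∷ v)) (λ v → h (true ∷ v))))
        (+-interchange (∑ n (λ v → g (false ∷ v))) _ _ _)

∑-*ˡ : ∀ {n} c (g : 𝔽₂^ n → ℤ) → ∑ n (λ v → c * g v) ≡ c * ∑ n g
∑-*ˡ {zero}  c g = refl
∑-*ˡ {suc n} c g =
  trans (cong₂ _+_ (∑-*ˡ c (λ v → g (false ∷ v))) (∑-*ˡ c (λ v → g (true ∷ v)))) (sym (ℤP.*-distribˡ-+ c _ _))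

∑-*ʳ : ∀ {n} c (g : 𝔽₂^ n → ℤ) → ∑ n (λ v → g v * c) ≡ ∑ n g * c
∑-*ʳ c g = trans (∑-cong (λ v → ℤP.*-comm (g v) c)) (trans (∑-*ˡ c g) (ℤP.*-comm c _))

∑-*-∑ : ∀ {m n} (g : 𝔽₂^ m → ℤ) (h : 𝔽₂^ n → ℤ) → ∑ m g * ∑ n h ≡ ∑ m (λ x → ∑ n (λ y → g x * h y))
∑-*-∑ {n = n} g h = trans (sym (∑-*ʳ (∑ n h) g)) (∑-cong (λ x → sym (∑-*ˡ (g x) h)))

∑-swap : ∀ {m n} (g : 𝔽₂^ m → 𝔽₂^ n → ℤ) →
  ∑ m (λ x → ∑ n (λ y → g x y)) ≡ ∑ n (λ y → ∑ m (λ x → g x y))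
∑-swap {zero}  g = refl
∑-swap {suc m} g =
  trans (cong₂ _+_ (∑-swap (λ x → g (false ∷ x))) (∑-swap (λ x → g (true ∷ x))))
        (sym (∑-+ (λ y → ∑ m (λ x → g (false ∷ x) y)) (λ y → ∑ m (λ x → g (true ∷ x) y))))

#𝔽₂^_ : ℕ → ℤ
#𝔽₂^ n = (+ 2) ^ n

∑-const : ∀ {n} c → ∑ n (λ _ → c) ≡ #𝔽₂^ n * c
∑-const {zero}  c = sym (ℤP.*-identityˡ c)
∑-const {suc n} c = begin
  ∑ n (λ _ → c) + ∑ n (λ _ → c)   ≡⟨ cong₂ _+_ (∑-const {n} c) (∑-const {n} c) ⟩
  #𝔽₂^ n * c + #𝔽₂^ n * c         ≡⟨ double (#𝔽₂^ n) c ⟩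
  + 2 * #𝔽₂^ n * c                ∎
  where
  open ≡-Reasoning
  double : ∀ N c → N * c + N * c ≡ + 2 * N * c
  double = solve-∀

∑-translate : ∀ {n} (g : 𝔽₂^ n → ℤ) c → ∑ n (λ x → g (x ⊕ c)) ≡ ∑ n g
∑-translate {zero}  g [] = refl
∑-translate {suc n} g (false ∷ c) =
  cong₂ _+_ (∑-translate (λ v → g (false ∷ v)) c) (∑-translate (λ v → g (true ∷ v)) c)
∑-translate {suc n} g (true ∷ c) =
  trans (cong₂ _+_ (∑-translate (λ v → g (true ∷ v)) c) (∑-translate (λ v → g (false ∷ v)) c))
        (ℤP.+-comm (∑ n (λ v → g (true ∷ v))) (∑ n (λ v → g (false ∷ v))))

∑-mono-≤ : ∀ {n} {g h : 𝔽₂^ n → ℤ} → (∀ v → g v ≤ h v) → ∑ n g ≤ ∑ n h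
∑-mono-≤ {zero}  g≤h = g≤h []
∑-mono-≤ {suc n} g≤h = ℤP.+-mono-≤ (∑-mono-≤ (λ v → g≤h (false ∷ v))) (∑-mono-≤ (λ v → g≤h (true ∷ v)))

∑-mono-< : ∀ {n} {g h : 𝔽₂^ n → ℤ} → (∀ v → g v ≤ h v) → ∀ u → g u < h u → ∑ n g < ∑ n h
∑-mono-< {zero}  g≤h [] g<h = g<h
∑-mono-< {suc n} g≤h (false ∷ u) g<h =
  ℤP.+-mono-<-≤ (∑-mono-< (λ v → g≤h (false ∷ v)) u g<h) (∑-mono-≤ (λ v → g≤h (true ∷ v)))
∑-mono-< {suc n} g≤h (true ∷ u) g<h =
  ℤP.+-mono-≤-< (∑-mono-≤ (λ v → g≤h (false ∷ v))) (∑-mono-< (λ v → g≤h (true ∷ v)) u g<h)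

∑-zero-or-≥ : ∀ {n} (g : 𝔽₂^ n → ℤ) L → + 0 ≤ L →
  (∀ v → g v ≡ + 0 ⊎ L ≤ g v) → ∑ n g ≡ + 0 ⊎ L ≤ ∑ n g
∑-zero-or-≥ {zero}  g L 0≤L gap = gap []
∑-zero-or-≥ {suc n} g L 0≤L gap =
  add (∑-zero-or-≥ _ L 0≤L (λ v → gap (false ∷ v))) (∑-zero-or-≥ _ L 0≤L (λ v → gap (true ∷ v)))
  where
  add : ∀ {a b} → a ≡ + 0 ⊎ L ≤ a → b ≡ + 0 ⊎ L ≤ b → a + b ≡ + 0 ⊎ L ≤ a + b
  add (inj₁ refl) (inj₁ refl) = inj₁ refl
  add (inj₁ refl) (inj₂ L≤b)  = inj₂ (subst (L ≤_) (sym (ℤP.+-identityˡ _)) L≤b)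
  add (inj₂ L≤a)  (inj₁ refl) = inj₂ (subst (L ≤_) (sym (ℤP.+-identityʳ _)) L≤a)
  add (inj₂ L≤a)  (inj₂ L≤b)  = inj₂ (ℤP.≤-trans L≤a (ℤP.i≤i+j _ _ {{ℤ.nonNegative (ℤP.≤-trans 0≤L L≤b)}}))

∑-allVecs : ∀ n (g : 𝔽₂^ n → ℤ) → foldr _+_ (+ 0) (map g (allVecs n)) ≡ ∑ n g
∑-allVecs zero    g = ℤP.+-identityʳ (g [])
∑-allVecs (suc n) g = begin
  foldr _+_ (+ 0) (map g (concatMap pairs (allVecs n)))
    ≡⟨ foldr-pairs (allVecs n) ⟩
  foldr _+_ (+ 0) (map (λ v → g (false ∷ v) + g (true ∷ v)) (allVecs n))
    ≡⟨ ∑-allVecs n _ ⟩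
  ∑ n (λ v → g (false ∷ v) + g (true ∷ v))
    ≡⟨ ∑-+ (λ v → g (false ∷ v)) (λ v → g (true ∷ v)) ⟩
  ∑ (suc n) g ∎
  where
  open ≡-Reasoning
  pairs : 𝔽₂^ n → List (𝔽₂^ (suc n))
  pairs v = (false ∷ v) ∷ (true ∷ v) ∷ []
  foldr-pairs : ∀ xs → foldr _+_ (+ 0) (map g (concatMap pairs xs))
                     ≡ foldr _+_ (+ 0) (map (λ v → g (false ∷ v) + g (true ∷ v)) xs)
  foldr-pairs []       = refl
  foldr-pairs (x ∷ xs) =
    trans (cong (λ s → g (false ∷ x) + (g (true ∷ x) + s)) (foldr-pairs xs)) (sym (ℤP.+-assoc (g (false ∷ x)) (g (true ∷ x)) _))

𝟙 : ∀ {p} {P : Set p} → Dec P → ℤ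
𝟙 (yes _) = + 1
𝟙 (no _)  = + 0

𝟙-yes : ∀ {p} {P : Set p} (P? : Dec P) → P → 𝟙 P? ≡ + 1
𝟙-yes (yes _) _ = refl
𝟙-yes (no ¬p) p = ⊥-elim (¬p p)

𝟙-no : ∀ {p} {P : Set p} (P? : Dec P) → ¬ P → 𝟙 P? ≡ + 0
𝟙-no (yes p) ¬p = ⊥-elim (¬p p)
𝟙-no (no _)  _  = refl

𝟙-⇔ : ∀ {p q} {P : Set p} {Q : Set q} (P? : Dec P) (Q? : Dec Q) → (P → Q) → (Q → P) → 𝟙 P? ≡ 𝟙 Q?
𝟙-⇔ (yes p) Q? P→Q Q→P = sym (𝟙-yes Q? (P→Q p))
𝟙-⇔ (no ¬p) Q? P→Q Q→P = sym (𝟙-no Q? (λ q → ¬p (Q→P q)))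

𝟙-nonneg : ∀ {p} {P : Set p} (P? : Dec P) → + 0 ≤ 𝟙 P?
𝟙-nonneg (yes _) = ℤ.+≤+ ℕ.z≤n
𝟙-nonneg (no _)  = ℤ.+≤+ ℕ.z≤n

𝟙≡0⊎𝟙≡1 : ∀ {p} {P : Set p} (P? : Dec P) → 𝟙 P? ≡ + 0 ⊎ 𝟙 P? ≡ + 1
𝟙≡0⊎𝟙≡1 (yes _) = inj₂ refl
𝟙≡0⊎𝟙≡1 (no _)  = inj₁ refl

filter-filter : ∀ {a p q} {A : Set a} {P : A → Set p} {Q : A → Set q}
  (P? : ∀ x → Dec (P x)) (Q? : ∀ x → Dec (Q x)) → (∀ {x} → P x → Q x) →
  ∀ xs → filter P? (filter Q? xs) ≡ filter P? xs
filter-filter P? Q? P⇒Q []       = refl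
filter-filter P? Q? P⇒Q (x ∷ xs) with Q? x
... | yes _ with P? x
...   | yes _ = cong (x ∷_) (filter-filter P? Q? P⇒Q xs)
...   | no _  = filter-filter P? Q? P⇒Q xs
filter-filter P? Q? P⇒Q (x ∷ xs) | no ¬Qx with P? x
...   | yes Px = ⊥-elim (¬Qx (P⇒Q Px))
...   | no _   = filter-filter P? Q? P⇒Q xs

count≡∑𝟙 : ∀ {n p} {P : 𝔽₂^ n → Set p} (P? : ∀ x → Dec (P x)) →
  + length (filter P? (allVecs n)) ≡ ∑ n (λ x → 𝟙 (P? x))
count≡∑𝟙 {n} P? = trans (length-filter (allVecs n)) (∑-allVecs n (λ x → 𝟙 (P? x)))
  where
  length-filter : ∀ xs → + length (filter P? xs) ≡ foldr _+_ (+ 0) (map (λ x → 𝟙 (P? x)) xs)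
  length-filter []       = refl
  length-filter (x ∷ xs) with P? x
  ... | yes _ = trans (ℤP.pos-+ 1 _) (cong (λ s → + 1 + s) (length-filter xs))
  ... | no _  = trans (length-filter xs) (sym (ℤP.+-identityˡ _))

δ : ∀ {n} → 𝔽₂^ n → 𝔽₂^ n → ℤ
δ u v = 𝟙 (u ≟ᵥ v)

δ-refl : ∀ {n} (u : 𝔽₂^ n) → δ u u ≡ + 1
δ-refl u = 𝟙-yes (u ≟ᵥ u) refl

δ-≢ : ∀ {n} {u v : 𝔽₂^ n} → ¬ u ≡ v → δ u v ≡ + 0
δ-≢ {u = u} {v} = 𝟙-no (u ≟ᵥ v)

δ-sym : ∀ {n} (u v : 𝔽₂^ n) → δ u v ≡ δ v u
δ-sym u v = 𝟙-⇔ (u ≟ᵥ v) (v ≟ᵥ u) sym sym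

δ-nonneg : ∀ {n} (u v : 𝔽₂^ n) → + 0 ≤ δ u v
δ-nonneg u v = 𝟙-nonneg (u ≟ᵥ v)

δ-∷ : ∀ {n} a (u v : 𝔽₂^ n) → δ (a ∷ u) (a ∷ v) ≡ δ u v
δ-∷ a u v = 𝟙-⇔ ((a ∷ u) ≟ᵥ (a ∷ v)) (u ≟ᵥ v) ∷-injectiveʳ (cong (a ∷_))

δ-∷-≢ : ∀ {n} a b (u v : 𝔽₂^ n) → ¬ a ≡ b → δ (a ∷ u) (b ∷ v) ≡ + 0
δ-∷-≢ a b u v a≢b = δ-≢ {u = a ∷ u} {b ∷ v} (λ eq → a≢b (∷-injectiveˡ eq))

∑-δ : ∀ {n} (g : 𝔽₂^ n → ℤ) u → ∑ n (λ v → g v * δ u v) ≡ g u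
∑-δ {zero}  g [] = ℤP.*-identityʳ (g [])
∑-δ {suc n} g (false ∷ u) = begin
  ∑ n (λ v → g (false ∷ v) * δ (false ∷ u) (false ∷ v)) + ∑ n (λ v → g (true ∷ v) * δ (false ∷ u) (true ∷ v))
    ≡⟨ cong₂ _+_ (∑-cong (λ v → cong (g (false ∷ v) *_) (δ-∷ false u v)))
                 (∑-vanish (λ v → trans (cong (g (true ∷ v) *_) (δ-∷-≢ false true u v (λ ()))) (ℤP.*-zeroʳ (g (true ∷ v))))) ⟩
  ∑ n (λ v → g (false ∷ v) * δ u v) + + 0
    ≡⟨ trans (ℤP.+-identityʳ _) (∑-δ (λ v → g (false ∷ v)) u) ⟩
  g (false ∷ u) ∎
  where open ≡-Reasoning
∑-δ {suc n} g (true ∷ u) = begin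
  ∑ n (λ v → g (false ∷ v) * δ (true ∷ u) (false ∷ v)) + ∑ n (λ v → g (true ∷ v) * δ (true ∷ u) (true ∷ v))
    ≡⟨ cong₂ _+_ (∑-vanish (λ v → trans (cong (g (false ∷ v) *_) (δ-∷-≢ true false u v (λ ()))) (ℤP.*-zeroʳ (g (false ∷ v)))))
                 (∑-cong (λ v → cong (g (true ∷ v) *_) (δ-∷ true u v))) ⟩
  + 0 + ∑ n (λ v → g (true ∷ v) * δ u v)
    ≡⟨ trans (ℤP.+-identityˡ _) (∑-δ (λ v → g (true ∷ v)) u) ⟩
  g (true ∷ u) ∎
  where open ≡-Reasoning

∑-outside-0ᵥ : ∀ {n} (g : 𝔽₂^ n → ℤ) c → (∀ u → ¬ u ≡ 0ᵥ → g u ≡ c) → ∑ n g ≡ #𝔽₂^ n * c + (g 0ᵥ - c)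
∑-outside-0ᵥ {n} g c g≡c = begin
  ∑ n g                                                   ≡⟨ ∑-cong split ⟩
  ∑ n (λ u → c + (g 0ᵥ - c) * δ 0ᵥ u)                     ≡⟨ ∑-+ {n} (λ _ → c) (λ u → (g 0ᵥ - c) * δ 0ᵥ u) ⟩
  ∑ n (λ _ → c) + ∑ n (λ u → (g 0ᵥ - c) * δ 0ᵥ u)
    ≡⟨ cong₂ _+_ (∑-const {n} c) (∑-δ {n} (λ _ → g 0ᵥ - c) 0ᵥ) ⟩
  #𝔽₂^ n * c + (g 0ᵥ - c)                                 ∎
  where
  open ≡-Reasoning
  at-0ᵥ : ∀ c g₀ → c + (g₀ - c) * + 1 ≡ g₀
  at-0ᵥ = solve-∀
  off-0ᵥ : ∀ c d → c + d * + 0 ≡ c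
  off-0ᵥ = solve-∀
  split : ∀ u → g u ≡ c + (g 0ᵥ - c) * δ 0ᵥ u
  split u with u ≟ᵥ 0ᵥ
  ... | yes refl = sym (trans (cong (λ d → c + (g 0ᵥ - c) * d) (δ-refl 0ᵥ)) (at-0ᵥ c (g 0ᵥ)))
  ... | no u≢0ᵥ  = trans (g≡c u u≢0ᵥ)
                     (sym (trans (cong (λ d → c + (g 0ᵥ - c) * d) (δ-≢ (u≢0ᵥ ∘ sym))) (off-0ᵥ c (g 0ᵥ - c))))

⊕-comm : ∀ {n} (x y : 𝔽₂^ n) → x ⊕ y ≡ y ⊕ x
⊕-comm []      []      = refl
⊕-comm (a ∷ x) (b ∷ y) = cong₂ _∷_ (xor-comm a b) (⊕-comm x y)

⊕-cancelʳ : ∀ {n} (x y : 𝔽₂^ n) → (x ⊕ y) ⊕ y ≡ x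
⊕-cancelʳ []      []      = refl
⊕-cancelʳ (a ∷ x) (b ∷ y) = cong₂ _∷_ (xor-cancelʳ a b) (⊕-cancelʳ x y)
  where
  xor-cancelʳ : ∀ a b → (a xor b) xor b ≡ a
  xor-cancelʳ a     false = trans (xor-identityʳ _) (xor-identityʳ a)
  xor-cancelʳ false true  = refl
  xor-cancelʳ true  true  = refl

⊕-self : ∀ {n} (x : 𝔽₂^ n) → x ⊕ x ≡ 0ᵥ
⊕-self []      = refl
⊕-self (a ∷ x) = cong₂ _∷_ (xor-same a) (⊕-self x)

⊕-identityʳ : ∀ {n} (x : 𝔽₂^ n) → x ⊕ 0ᵥ ≡ x
⊕-identityʳ []      = refl
⊕-identityʳ (a ∷ x) = cong₂ _∷_ (xor-identityʳ a) (⊕-identityʳ x)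

⊕≡0ᵥ⇒≡ : ∀ {n} {x y : 𝔽₂^ n} → x ⊕ y ≡ 0ᵥ → x ≡ y
⊕≡0ᵥ⇒≡ {x = x} {y} eq = begin
  x             ≡⟨ sym (⊕-cancelʳ x y) ⟩
  (x ⊕ y) ⊕ y   ≡⟨ cong (_⊕ y) eq ⟩
  0ᵥ ⊕ y        ≡⟨ ⊕-comm 0ᵥ y ⟩
  y ⊕ 0ᵥ        ≡⟨ ⊕-identityʳ y ⟩
  y             ∎
  where open ≡-Reasoning

δ-⊕-0ᵥ : ∀ {n} (u v : 𝔽₂^ n) → δ (u ⊕ v) 0ᵥ ≡ δ u v
δ-⊕-0ᵥ u v = 𝟙-⇔ ((u ⊕ v) ≟ᵥ 0ᵥ) (u ≟ᵥ v) ⊕≡0ᵥ⇒≡ (λ u≡v → trans (cong (_⊕ v) u≡v) (⊕-self v))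

sign-xor : ∀ p q → sign (p xor q) ≡ sign p * sign q
sign-xor false q     = sym (ℤP.*-identityˡ (sign q))
sign-xor true  false = refl
sign-xor true  true  = refl

sign*sign : ∀ p → sign p * sign p ≡ + 1
sign*sign false = refl
sign*sign true  = refl

χ : ∀ {n} → 𝔽₂^ n → 𝔽₂^ n → ℤ
χ a x = sign ⟨ a , x ⟩

χ-comm : ∀ {n} (a x : 𝔽₂^ n) → χ a x ≡ χ x a
χ-comm a x = cong sign (⟨⟩-comm a x)
  where
  ⟨⟩-comm : ∀ {n} (a x : 𝔽₂^ n) → ⟨ a , x ⟩ ≡ ⟨ x , a ⟩
  ⟨⟩-comm []       []       = refl
  ⟨⟩-comm (a ∷ as) (x ∷ xs) = cong₂ _xor_ (∧-comm a x) (⟨⟩-comm as xs)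

χ-⊕ : ∀ {n} (a x y : 𝔽₂^ n) → χ a (x ⊕ y) ≡ χ a x * χ a y
χ-⊕ []       []      []      = refl
χ-⊕ (a₀ ∷ a) (p ∷ x) (q ∷ y) = begin
  sign ((a₀ ∧ (p xor q)) xor ⟨ a , x ⊕ y ⟩)
    ≡⟨ sign-xor (a₀ ∧ (p xor q)) ⟨ a , x ⊕ y ⟩ ⟩
  sign (a₀ ∧ (p xor q)) * χ a (x ⊕ y)
    ≡⟨ cong₂ _*_ (trans (cong sign (∧-distribˡ-xor a₀ p q)) (sign-xor (a₀ ∧ p) (a₀ ∧ q))) (χ-⊕ a x y) ⟩
  (sign (a₀ ∧ p) * sign (a₀ ∧ q)) * (χ a x * χ a y)
    ≡⟨ *-interchange (sign (a₀ ∧ p)) _ _ _ ⟩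
  (sign (a₀ ∧ p) * χ a x) * (sign (a₀ ∧ q) * χ a y)
    ≡⟨ sym (cong₂ _*_ (sign-xor (a₀ ∧ p) ⟨ a , x ⟩) (sign-xor (a₀ ∧ q) ⟨ a , y ⟩)) ⟩
  χ (a₀ ∷ a) (p ∷ x) * χ (a₀ ∷ a) (q ∷ y) ∎
  where open ≡-Reasoning

χ-0ᵥ : ∀ {n} (x : 𝔽₂^ n) → χ 0ᵥ x ≡ + 1
χ-0ᵥ []      = refl
χ-0ᵥ (_ ∷ x) = χ-0ᵥ x

χ*χ : ∀ {n} (a x : 𝔽₂^ n) → χ a x * χ a x ≡ + 1
χ*χ a x = sign*sign ⟨ a , x ⟩

∑-χ : ∀ {n} (a : 𝔽₂^ n) → ∑ n (λ x → χ a x) ≡ #𝔽₂^ n * δ a 0ᵥ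
∑-χ {zero}  [] = refl
∑-χ {suc n} (false ∷ a) = begin
  ∑ n (χ a) + ∑ n (χ a)                       ≡⟨ cong₂ _+_ (∑-χ a) (∑-χ a) ⟩
  #𝔽₂^ n * δ a 0ᵥ + #𝔽₂^ n * δ a 0ᵥ           ≡⟨ double (#𝔽₂^ n) (δ a 0ᵥ) ⟩
  #𝔽₂^ suc n * δ a 0ᵥ                         ≡⟨ cong (#𝔽₂^ suc n *_) (δ-∷ false a 0ᵥ) ⟨
  #𝔽₂^ suc n * δ (false ∷ a) 0ᵥ               ∎
  where
  open ≡-Reasoning
  double : ∀ N d → N * d + N * d ≡ + 2 * N * d
  double = solve-∀
∑-χ {suc n} (true ∷ a) = begin
  ∑ n (χ a) + ∑ n (λ x → sign (not ⟨ a , x ⟩))   ≡⟨ cong (_+_ (∑ n (χ a))) (∑-cong (λ x → sign-not ⟨ a , x ⟩)) ⟩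
  ∑ n (χ a) + ∑ n (λ x → -1ℤ * χ a x)           ≡⟨ cong (_+_ (∑ n (χ a))) (∑-*ˡ -1ℤ (χ a)) ⟩
  ∑ n (χ a) + -1ℤ * ∑ n (χ a)                   ≡⟨ cancel (∑ n (χ a)) ⟩
  + 0                                           ≡⟨ ℤP.*-zeroʳ (#𝔽₂^ suc n) ⟨
  #𝔽₂^ suc n * + 0                              ≡⟨ cong (#𝔽₂^ suc n *_) (δ-∷-≢ true false a 0ᵥ (λ ())) ⟨
  #𝔽₂^ suc n * δ (true ∷ a) 0ᵥ                  ∎
  where
  open ≡-Reasoning
  sign-not : ∀ p → sign (not p) ≡ -1ℤ * sign p
  sign-not false = refl
  sign-not true  = refl
  cancel : ∀ s → s + -1ℤ * s ≡ + 0
  cancel = solve-∀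

orthogonality : ∀ {n} (u v : 𝔽₂^ n) → ∑ n (λ a → χ a u * χ a v) ≡ #𝔽₂^ n * δ u v
orthogonality {n} u v = begin
  ∑ n (λ a → χ a u * χ a v)     ≡⟨ ∑-cong (λ a → trans (sym (χ-⊕ a u v)) (χ-comm a (u ⊕ v))) ⟩
  ∑ n (χ (u ⊕ v))               ≡⟨ ∑-χ (u ⊕ v) ⟩
  #𝔽₂^ n * δ (u ⊕ v) 0ᵥ         ≡⟨ cong (#𝔽₂^ n *_) (δ-⊕-0ᵥ u v) ⟩
  #𝔽₂^ n * δ u v                ∎
  where open ≡-Reasoning

plancherel : ∀ {m n} (h : 𝔽₂^ m → 𝔽₂^ n) (g : 𝔽₂^ m → ℤ) →
  ∑ n (λ a → ∑ m (λ x → χ a (h x) * g x) * ∑ m (λ x → χ a (h x) * g x))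
    ≡ #𝔽₂^ n * ∑ m (λ x → ∑ m (λ z → (g x * g z) * δ (h x) (h z)))
plancherel {m} {n} h g = begin
  ∑ n (λ a → ∑ m (term a) * ∑ m (term a))
    ≡⟨ ∑-cong (λ a → ∑-*-∑ (term a) (term a)) ⟩
  ∑ n (λ a → ∑ m (λ x → ∑ m (λ z → term a x * term a z)))
    ≡⟨ ∑-swap (λ a x → ∑ m (λ z → term a x * term a z)) ⟩
  ∑ m (λ x → ∑ n (λ a → ∑ m (λ z → term a x * term a z)))
    ≡⟨ ∑-cong (λ x → ∑-swap (λ a z → term a x * term a z)) ⟩
  ∑ m (λ x → ∑ m (λ z → ∑ n (λ a → term a x * term a z)))
    ≡⟨ ∑-cong (λ x → ∑-cong (λ z → over-a x z)) ⟩
  ∑ m (λ x → ∑ m (λ z → #𝔽₂^ n * ((g x * g z) * δ (h x) (h z))))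
    ≡⟨ trans (∑-cong (λ x → ∑-*ˡ (#𝔽₂^ n) (pair x))) (∑-*ˡ (#𝔽₂^ n) (λ x → ∑ m (pair x))) ⟩
  #𝔽₂^ n * ∑ m (λ x → ∑ m (λ z → (g x * g z) * δ (h x) (h z))) ∎
  where
  open ≡-Reasoning
  term : 𝔽₂^ n → 𝔽₂^ m → ℤ
  term a x = χ a (h x) * g x
  pair : 𝔽₂^ m → 𝔽₂^ m → ℤ
  pair x z = (g x * g z) * δ (h x) (h z)
  over-a : ∀ x z → ∑ n (λ a → term a x * term a z) ≡ #𝔽₂^ n * ((g x * g z) * δ (h x) (h z))
  over-a x z = begin
    ∑ n (λ a → term a x * term a z)                  ≡⟨ ∑-cong (λ a → *-interchange (χ a (h x)) (g x) _ _) ⟩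
    ∑ n (λ a → (χ a (h x) * χ a (h z)) * (g x * g z)) ≡⟨ ∑-*ʳ (g x * g z) (λ a → χ a (h x) * χ a (h z)) ⟩
    ∑ n (λ a → χ a (h x) * χ a (h z)) * (g x * g z)  ≡⟨ cong (_* (g x * g z)) (orthogonality (h x) (h z)) ⟩
    (#𝔽₂^ n * δ (h x) (h z)) * (g x * g z)           ≡⟨ rearrange (#𝔽₂^ n) _ _ ⟩
    #𝔽₂^ n * ((g x * g z) * δ (h x) (h z))           ∎
    where
    rearrange : ∀ N d p → (N * d) * p ≡ N * (p * d)
    rearrange = solve-∀

fourier : ∀ {n} → (𝔽₂^ n → ℤ) → 𝔽₂^ n → ℤ
fourier {n} g a = ∑ n (λ x → χ a x * g x)

parseval : ∀ {n} (g : 𝔽₂^ n → ℤ) → ∑ n (λ a → fourier g a * fourier g a) ≡ #𝔽₂^ n * ∑ n (λ x → g x * g x)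
parseval {n} g = trans (plancherel (λ x → x) g) (cong (#𝔽₂^ n *_) (∑-cong (λ x → ∑-δ (λ z → g x * g z) x)))

collisions : ∀ {m n} → (𝔽₂^ m → 𝔽₂^ n) → ℤ
collisions {m} h = ∑ m (λ x → ∑ m (λ z → δ (h z) (h x)))

∑-χ∘-square : ∀ {m n} (h : 𝔽₂^ m → 𝔽₂^ n) →
  ∑ n (λ a → ∑ m (λ x → χ a (h x)) * ∑ m (λ x → χ a (h x))) ≡ #𝔽₂^ n * collisions h
∑-χ∘-square {m} {n} h = begin
  ∑ n (λ a → ∑ m (λ x → χ a (h x)) * ∑ m (λ x → χ a (h x)))
    ≡⟨ ∑-cong (λ a → cong (λ s → s * s) (∑-cong (λ x → sym (ℤP.*-identityʳ (χ a (h x)))))) ⟩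
  ∑ n (λ a → ∑ m (λ x → χ a (h x) * + 1) * ∑ m (λ x → χ a (h x) * + 1))
    ≡⟨ plancherel h (λ _ → + 1) ⟩
  #𝔽₂^ n * ∑ m (λ x → ∑ m (λ z → + 1 * δ (h x) (h z)))
    ≡⟨ cong (#𝔽₂^ n *_) (∑-cong (λ x → ∑-cong (λ z → trans (ℤP.*-identityˡ _) (δ-sym (h x) (h z))))) ⟩
  #𝔽₂^ n * collisions h ∎
  where open ≡-Reasoning

autocorrelation : ∀ {n} → (𝔽₂^ n → ℤ) → 𝔽₂^ n → ℤ
autocorrelation {n} g u = ∑ n (λ x → g (x ⊕ u) * g x)

fourier-square : ∀ {n} (g : 𝔽₂^ n → ℤ) a → fourier g a * fourier g a ≡ fourier (autocorrelation g) a
fourier-square {n} g a = begin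
  fourier g a * fourier g a
    ≡⟨ ∑-*-∑ (term a) (term a) ⟩
  ∑ n (λ x → ∑ n (λ y → term a x * term a y))
    ≡⟨ ∑-cong (λ x → sym (∑-translate (λ y → term a x * term a y) x)) ⟩
  ∑ n (λ x → ∑ n (λ u → term a x * term a (u ⊕ x)))
    ≡⟨ ∑-cong (λ x → ∑-cong (λ u → shift x u)) ⟩
  ∑ n (λ x → ∑ n (λ u → χ a u * (g (x ⊕ u) * g x)))
    ≡⟨ ∑-swap (λ x u → χ a u * (g (x ⊕ u) * g x)) ⟩
  ∑ n (λ u → ∑ n (λ x → χ a u * (g (x ⊕ u) * g x)))
    ≡⟨ ∑-cong (λ u → ∑-*ˡ (χ a u) (λ x → g (x ⊕ u) * g x)) ⟩
  fourier (autocorrelation g) a ∎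
  where
  open ≡-Reasoning
  term : 𝔽₂^ n → 𝔽₂^ n → ℤ
  term a x = χ a x * g x
  regroup : ∀ c d p q → (c * p) * ((c * d) * q) ≡ (c * c) * (d * (q * p))
  regroup = solve-∀
  shift : ∀ x u → term a x * term a (u ⊕ x) ≡ χ a u * (g (x ⊕ u) * g x)
  shift x u = begin
    (χ a x * g x) * (χ a (u ⊕ x) * g (u ⊕ x))
      ≡⟨ cong (λ y → (χ a x * g x) * (χ a y * g y)) (⊕-comm u x) ⟩
    (χ a x * g x) * (χ a (x ⊕ u) * g (x ⊕ u))
      ≡⟨ cong (λ c → (χ a x * g x) * (c * g (x ⊕ u))) (χ-⊕ a x u) ⟩
    (χ a x * g x) * ((χ a x * χ a u) * g (x ⊕ u))
      ≡⟨ regroup (χ a x) (χ a u) (g x) (g (x ⊕ u)) ⟩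
    (χ a x * χ a x) * (χ a u * (g (x ⊕ u) * g x))
      ≡⟨ trans (cong (_* (χ a u * (g (x ⊕ u) * g x))) (χ*χ a x)) (ℤP.*-identityˡ _) ⟩
    χ a u * (g (x ⊕ u) * g x) ∎

walsh≡fourier : ∀ {n} (f : 𝔽₂^ n → Bool) a → walsh f a ≡ fourier (λ x → sign (f x)) a
walsh≡fourier {n} f a = trans (∑-allVecs n (λ x → sign (f x xor ⟨ a , x ⟩)))
  (∑-cong (λ x → trans (sign-xor (f x) ⟨ a , x ⟩) (ℤP.*-comm (sign (f x)) (χ a x))))

*-pos : ∀ {i j} → + 0 < i → + 0 < j → + 0 < i * j
*-pos {i} {j} i>0 j>0 = ℤP.*-monoʳ-<-pos j {{ℤ.positive j>0}} i>0

#𝔽₂^-pos : ∀ n → + 0 < #𝔽₂^ n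
#𝔽₂^-pos zero    = ℤP.positive⁻¹ _
#𝔽₂^-pos (suc n) = *-pos {+ 2} (ℤP.positive⁻¹ _) (#𝔽₂^-pos n)

pos-^ : ∀ a k → + (a ℕ.^ k) ≡ (+ a) ^ k
pos-^ a zero    = refl
pos-^ a (suc k) = trans (ℤP.pos-* a (a ℕ.^ k)) (cong (+ a *_) (pos-^ a k))

4^≡#𝔽₂^*#𝔽₂^ : ∀ n → (+ 4) ^ n ≡ #𝔽₂^ n * #𝔽₂^ n
4^≡#𝔽₂^*#𝔽₂^ zero    = refl
4^≡#𝔽₂^*#𝔽₂^ (suc n) = trans (cong (+ 4 *_) (4^≡#𝔽₂^*#𝔽₂^ n)) (regroup (#𝔽₂^ n))
  where
  regroup : ∀ N → + 4 * (N * N) ≡ (+ 2 * N) * (+ 2 * N)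
  regroup = solve-∀

4^-pos : ∀ m → + 0 < (+ 4) ^ m
4^-pos m = subst (+ 0 <_) (pos-^ 4 m) (ℤ.+<+ (ℕP.m^n>0 4 m))

4^<4^⇒4*4^≤4^ : ∀ k m → (+ 4) ^ k < (+ 4) ^ m → + 4 * (+ 4) ^ k ≤ (+ 4) ^ m
4^<4^⇒4*4^≤4^ k m lt = subst₂ _≤_ (pos-^ 4 (suc k)) (pos-^ 4 m) (ℤ.+≤+ (ℕP.^-monoʳ-≤ 4 k<m))
  where
  4^k<4^m : 4 ℕ.^ k ℕ.< 4 ℕ.^ m
  4^k<4^m = ℤP.drop‿+<+ (subst₂ _<_ (sym (pos-^ 4 k)) (sym (pos-^ 4 m)) lt)
  k<m : k ℕ.< m
  k<m = ℕP.≰⇒> (λ m≤k → ℕP.<⇒≱ 4^k<4^m (ℕP.^-monoʳ-≤ 4 m≤k))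

even⇒#𝔽₂^≡4^ : ∀ n → n % 2 ≡ 0 → ∃ λ k → #𝔽₂^ n ≡ (+ 4) ^ k
even⇒#𝔽₂^≡4^ n n-even with m%n≡0⇒n∣m n 2 n-even
... | divides k n≡k*2 = k , trans (cong ((+ 2) ^_) (trans n≡k*2 (ℕP.*-comm k 2))) (sym (ℤP.^-*-assoc (+ 2) 2 k))

i*i≡∣i∣*∣i∣ : ∀ i → i * i ≡ + (ℤ.∣ i ∣ ℕ.* ℤ.∣ i ∣)
i*i≡∣i∣*∣i∣ (+ k)    = sym (ℤP.pos-* k k)
i*i≡∣i∣*∣i∣ -[1+ k ] = refl

Plateau : ∀ {n} → ℤ → (𝔽₂^ n → ℤ) → Set
Plateau K w = ∀ a → w a * w a ≡ + 0 ⊎ w a * w a ≡ K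

plateaued⇒Plateau : ∀ {n s} (f : 𝔽₂^ n → Bool) → IsPlateaued n s f →
  Plateau ((+ 4) ^ ((n ℕ.+ s) ℕ./ 2)) (walsh f)
plateaued⇒Plateau {n} {s} f plateaued a with plateaued a
... | inj₁ ∣W∣≡0 = inj₁ (trans (i*i≡∣i∣*∣i∣ (walsh f a)) (cong (λ k → + (k ℕ.* k)) ∣W∣≡0))
... | inj₂ (_ , ∣W∣≡2^m) = inj₂ (begin
  walsh f a * walsh f a                  ≡⟨ i*i≡∣i∣*∣i∣ (walsh f a) ⟩
  + (ℤ.∣ walsh f a ∣ ℕ.* ℤ.∣ walsh f a ∣) ≡⟨ cong (λ k → + (k ℕ.* k)) ∣W∣≡2^m ⟩
  + (2 ℕ.^ m ℕ.* 2 ℕ.^ m)               ≡⟨ ℤP.pos-* (2 ℕ.^ m) (2 ℕ.^ m) ⟩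
  + (2 ℕ.^ m) * + (2 ℕ.^ m)             ≡⟨ cong₂ _*_ (pos-^ 2 m) (pos-^ 2 m) ⟩
  #𝔽₂^ m * #𝔽₂^ m                        ≡⟨ 4^≡#𝔽₂^*#𝔽₂^ m ⟨
  (+ 4) ^ m                              ∎)
  where
  open ≡-Reasoning
  m : ℕ
  m = (n ℕ.+ s) ℕ./ 2

excess : ∀ {n} → (𝔽₂^ n → ℤ) → ℤ
excess {n} w = ∑ n (λ a → (w a * w a) * (w a * w a)) - (#𝔽₂^ n * #𝔽₂^ n) * (w 0ᵥ * w 0ᵥ)

excess-plateau : ∀ {n K} (w : 𝔽₂^ n → ℤ) → Plateau K w →
  ∑ n (λ a → w a * w a) ≡ #𝔽₂^ n * #𝔽₂^ n → excess w ≡ (K - w 0ᵥ * w 0ᵥ) * (#𝔽₂^ n * #𝔽₂^ n)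
excess-plateau {n} {K} w plateau parseval-w = begin
  ∑ n (λ a → (w a * w a) * (w a * w a)) - NN * (w 0ᵥ * w 0ᵥ)
    ≡⟨ cong (_- NN * (w 0ᵥ * w 0ᵥ)) (∑-cong fourth-power) ⟩
  ∑ n (λ a → K * (w a * w a)) - NN * (w 0ᵥ * w 0ᵥ)
    ≡⟨ cong (_- NN * (w 0ᵥ * w 0ᵥ)) (trans (∑-*ˡ K (λ a → w a * w a)) (cong (K *_) parseval-w)) ⟩
  K * NN - NN * (w 0ᵥ * w 0ᵥ)
    ≡⟨ factor K NN (w 0ᵥ * w 0ᵥ) ⟩
  (K - w 0ᵥ * w 0ᵥ) * NN ∎
  where
  open ≡-Reasoning
  NN : ℤ
  NN = #𝔽₂^ n * #𝔽₂^ n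
  factor : ∀ K M s → K * M - M * s ≡ (K - s) * M
  factor = solve-∀
  fourth-power : ∀ a → (w a * w a) * (w a * w a) ≡ K * (w a * w a)
  fourth-power a with plateau a
  ... | inj₁ w²≡0 rewrite w²≡0 = sym (ℤP.*-zeroʳ K)
  ... | inj₂ w²≡K rewrite w²≡K = refl

plateau-amplitude> : ∀ {n K} (w : 𝔽₂^ n → ℤ) → Plateau K w → + 0 < K →
  ∑ n (λ a → w a * w a) ≡ #𝔽₂^ n * #𝔽₂^ n → w 0ᵥ * w 0ᵥ ≡ + 0 → #𝔽₂^ n < K
plateau-amplitude> {n} {K} w plateau K>0 parseval-w w₀≡0 =
  ℤP.*-cancelˡ-<-nonNeg (#𝔽₂^ n) {{ℤ.nonNegative (ℤP.<⇒≤ (#𝔽₂^-pos n))}} NN<NK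
  where
  w²≤K : ∀ a → w a * w a ≤ K
  w²≤K a with plateau a
  ... | inj₁ w²≡0 = subst (_≤ K) (sym w²≡0) (ℤP.<⇒≤ K>0)
  ... | inj₂ w²≡K = ℤP.≤-reflexive w²≡K
  NN<NK : #𝔽₂^ n * #𝔽₂^ n < #𝔽₂^ n * K
  NN<NK = subst₂ _<_ parseval-w (∑-const {n} K) (∑-mono-< w²≤K 0ᵥ (subst (_< K) (sym w₀≡0) K>0))

excess-zero-or-≥ : ∀ {n} k m (w : 𝔽₂^ n → ℤ) → #𝔽₂^ n ≡ (+ 4) ^ k → Plateau ((+ 4) ^ m) w →
  ∑ n (λ a → w a * w a) ≡ #𝔽₂^ n * #𝔽₂^ n →
  excess w ≡ + 0 ⊎ + 4 * (#𝔽₂^ n * #𝔽₂^ n * #𝔽₂^ n) ≤ excess w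
excess-zero-or-≥ {n} k m w N≡4^k plateau parseval-w = by-w₀² (plateau 0ᵥ)
  where
  N K NN : ℤ
  N  = #𝔽₂^ n
  K  = (+ 4) ^ m
  NN = N * N
  NN≥0 : + 0 ≤ NN
  NN≥0 = ℤP.<⇒≤ (*-pos (#𝔽₂^-pos n) (#𝔽₂^-pos n))
  excess≡ : excess w ≡ (K - w 0ᵥ * w 0ᵥ) * NN
  excess≡ = excess-plateau w plateau parseval-w
  4N≤K : w 0ᵥ * w 0ᵥ ≡ + 0 → + 4 * N ≤ K
  4N≤K w₀²≡0 = subst (λ x → + 4 * x ≤ K) (sym N≡4^k)
    (4^<4^⇒4*4^≤4^ k m (subst (_< K) N≡4^k (plateau-amplitude> w plateau (4^-pos m) parseval-w w₀²≡0)))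
  regroup : ∀ N → + 4 * (N * N * N) ≡ (+ 4 * N) * (N * N)
  regroup = solve-∀
  by-w₀² : w 0ᵥ * w 0ᵥ ≡ + 0 ⊎ w 0ᵥ * w 0ᵥ ≡ K → excess w ≡ + 0 ⊎ + 4 * (N * N * N) ≤ excess w
  by-w₀² (inj₂ w₀²≡K) = inj₁ (begin-equality
    excess w                    ≡⟨ excess≡ ⟩
    (K - w 0ᵥ * w 0ᵥ) * NN      ≡⟨ cong (λ s → (K - s) * NN) w₀²≡K ⟩
    (K - K) * NN                ≡⟨ cong (_* NN) (ℤP.+-inverseʳ K) ⟩
    + 0                         ∎)
    where open ℤP.≤-Reasoning
  by-w₀² (inj₁ w₀²≡0) = inj₂ (begin
    + 4 * (N * N * N)           ≡⟨ regroup N ⟩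
    (+ 4 * N) * NN              ≤⟨ ℤP.*-monoʳ-≤-nonNeg NN {{ℤ.nonNegative NN≥0}} (4N≤K w₀²≡0) ⟩
    K * NN                      ≡⟨ cong (_* NN) (ℤP.+-identityʳ K) ⟨
    (K - + 0) * NN              ≡⟨ cong (λ s → (K - s) * NN) w₀²≡0 ⟨
    (K - w 0ᵥ * w 0ᵥ) * NN      ≡⟨ excess≡ ⟨
    excess w                    ∎)
    where open ℤP.≤-Reasoning

2P-neither-0-nor-≥4P : ∀ {P} → + 0 < P → ¬ (+ 2 * P ≡ + 0 ⊎ + 4 * P ≤ + 2 * P)
2P-neither-0-nor-≥4P P>0 (inj₁ 2P≡0) = ℤP.<-irrefl (sym 2P≡0) (*-pos {+ 2} (ℤP.positive⁻¹ _) P>0)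
2P-neither-0-nor-≥4P {P} P>0 (inj₂ 4P≤2P) with ℤP.*-cancelʳ-≤-pos (+ 4) (+ 2) P {{ℤ.positive P>0}} 4P≤2P
... | ℤ.+≤+ (ℕ.s≤s (ℕ.s≤s ()))

module _ {n : ℕ} (F : 𝔽₂^ n → 𝔽₂^ n) where

  private
    N : ℤ
    N = #𝔽₂^ n

  W : 𝔽₂^ n → 𝔽₂^ n → ℤ
  W b = walsh (component F b)

  Δ : 𝔽₂^ n → 𝔽₂^ n → 𝔽₂^ n
  Δ u x = F (x ⊕ u) ⊕ F x

  W≡fourier : ∀ b a → W b a ≡ fourier (λ x → χ b (F x)) a
  W≡fourier b = walsh≡fourier (component F b)

  parseval-W : ∀ b → ∑ n (λ a → W b a * W b a) ≡ N * N
  parseval-W b = begin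
    ∑ n (λ a → W b a * W b a)                               ≡⟨ ∑-cong (λ a → cong (λ w → w * w) (W≡fourier b a)) ⟩
    ∑ n (λ a → fourier g a * fourier g a)                   ≡⟨ parseval g ⟩
    N * ∑ n (λ x → χ b (F x) * χ b (F x))                   ≡⟨ cong (N *_) (∑-cong (λ x → χ*χ b (F x))) ⟩
    N * ∑ n (λ _ → + 1)                                     ≡⟨ cong (N *_) (∑-const {n} (+ 1)) ⟩
    N * (N * + 1)                                           ≡⟨ cong (N *_) (ℤP.*-identityʳ N) ⟩
    N * N                                                   ∎
    where
    open ≡-Reasoning
    g : 𝔽₂^ n → ℤ
    g x = χ b (F x)

  W²≡fourier : ∀ b a → W b a * W b a ≡ fourier (λ u → ∑ n (λ x → χ b (Δ u x))) a
  W²≡fourier b a = begin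
    W b a * W b a                                            ≡⟨ cong (λ w → w * w) (W≡fourier b a) ⟩
    fourier g a * fourier g a                                ≡⟨ fourier-square g a ⟩
    fourier (autocorrelation g) a
      ≡⟨ ∑-cong (λ u → cong (χ a u *_) (∑-cong (λ x → sym (χ-⊕ b (F (x ⊕ u)) (F x))))) ⟩
    fourier (λ u → ∑ n (λ x → χ b (Δ u x))) a                ∎
    where
    open ≡-Reasoning
    g : 𝔽₂^ n → ℤ
    g x = χ b (F x)

  fourth-moment : ∑ n (λ b → ∑ n (λ a → (W b a * W b a) * (W b a * W b a)))
                    ≡ N * (N * ∑ n (λ u → collisions (Δ u)))
  fourth-moment = begin
    ∑ n (λ b → ∑ n (λ a → (W b a * W b a) * (W b a * W b a)))
      ≡⟨ ∑-cong (λ b → ∑-cong (λ a → cong (λ w → w * w) (W²≡fourier b a))) ⟩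
    ∑ n (λ b → ∑ n (λ a → fourier (C b) a * fourier (C b) a))
      ≡⟨ ∑-cong (λ b → parseval (C b)) ⟩
    ∑ n (λ b → N * ∑ n (λ u → C b u * C b u))
      ≡⟨ ∑-*ˡ N (λ b → ∑ n (λ u → C b u * C b u)) ⟩
    N * ∑ n (λ b → ∑ n (λ u → C b u * C b u))
      ≡⟨ cong (N *_) (∑-swap (λ b u → C b u * C b u)) ⟩
    N * ∑ n (λ u → ∑ n (λ b → C b u * C b u))
      ≡⟨ cong (N *_) (∑-cong (λ u → ∑-χ∘-square (Δ u))) ⟩
    N * ∑ n (λ u → N * collisions (Δ u))
      ≡⟨ cong (N *_) (∑-*ˡ N (λ u → collisions (Δ u))) ⟩
    N * (N * ∑ n (λ u → collisions (Δ u))) ∎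
    where
    open ≡-Reasoning
    C : 𝔽₂^ n → 𝔽₂^ n → ℤ
    C b u = ∑ n (λ x → χ b (Δ u x))

  second-moment-at-0ᵥ : ∑ n (λ b → W b 0ᵥ * W b 0ᵥ) ≡ N * collisions F
  second-moment-at-0ᵥ = trans (∑-cong (λ b → cong (λ w → w * w) (W-at-0ᵥ b))) (∑-χ∘-square F)
    where
    W-at-0ᵥ : ∀ b → W b 0ᵥ ≡ ∑ n (λ x → χ b (F x))
    W-at-0ᵥ b = trans (W≡fourier b 0ᵥ) (∑-cong (λ x → trans (cong (_* χ b (F x)) (χ-0ᵥ x)) (ℤP.*-identityˡ _)))

  Δ-shift : ∀ u x → Δ u (x ⊕ u) ≡ Δ u x
  Δ-shift u x = trans (cong (λ y → F y ⊕ F (x ⊕ u)) (⊕-cancelʳ x u)) (⊕-comm (F x) (F (x ⊕ u)))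

  derivCount≥2 : ∀ u x → ¬ u ≡ 0ᵥ → 2 ℕ.≤ derivCount F u (Δ u x)
  derivCount≥2 u x u≢0ᵥ = ℤP.drop‿+≤+ (begin
    + 2                                            ≡⟨ cong₂ _+_ (single x) (single (x ⊕ u)) ⟨
    ∑ n (δ x) + ∑ n (δ (x ⊕ u))                    ≡⟨ ∑-+ (δ x) (δ (x ⊕ u)) ⟨
    ∑ n (λ z → δ x z + δ (x ⊕ u) z)                ≤⟨ ∑-mono-≤ two-solutions ⟩
    ∑ n (λ z → δ (Δ u z) (Δ u x))                  ≡⟨ count≡∑𝟙 (λ z → Δ u z ≟ᵥ Δ u x) ⟨
    + derivCount F u (Δ u x)                       ∎)
    where
    open ℤP.≤-Reasoning
    single : ∀ y → ∑ n (δ y) ≡ + 1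
    single y = trans (∑-cong (λ z → sym (ℤP.*-identityˡ (δ y z)))) (∑-δ (λ _ → + 1) y)
    x⊕u≢x : ¬ x ⊕ u ≡ x
    x⊕u≢x eq = u≢0ᵥ (trans (sym (⊕-cancelʳ u x)) (trans (cong (_⊕ x) (trans (⊕-comm u x) eq)) (⊕-self x)))
    two-solutions : ∀ z → δ x z + δ (x ⊕ u) z ≤ δ (Δ u z) (Δ u x)
    two-solutions z with x ≟ᵥ z
    ... | yes refl = ℤP.≤-reflexive (trans (cong (_+_ (+ 1)) (δ-≢ x⊕u≢x)) (sym (δ-refl (Δ u x))))
    ... | no x≢z with (x ⊕ u) ≟ᵥ z
    ...   | yes refl = ℤP.≤-reflexive (sym (trans (cong (λ y → δ y (Δ u x)) (Δ-shift u x)) (δ-refl (Δ u x))))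
    ...   | no _     = δ-nonneg (Δ u z) (Δ u x)

  collisions-Δ-0ᵥ : collisions (Δ 0ᵥ) ≡ N * N
  collisions-Δ-0ᵥ = begin
    ∑ n (λ x → ∑ n (λ z → δ (Δ 0ᵥ z) (Δ 0ᵥ x)))
      ≡⟨ ∑-cong (λ x → ∑-cong (λ z → trans (cong₂ δ (Δ-0ᵥ z) (Δ-0ᵥ x)) (δ-refl 0ᵥ))) ⟩
    ∑ n (λ x → ∑ n (λ z → + 1))                   ≡⟨ ∑-cong {n} (λ _ → ∑-const {n} (+ 1)) ⟩
    ∑ n (λ x → N * + 1)                           ≡⟨ ∑-const {n} (N * + 1) ⟩
    N * (N * + 1)                                 ≡⟨ cong (N *_) (ℤP.*-identityʳ N) ⟩
    N * N                                         ∎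
    where
    open ≡-Reasoning
    Δ-0ᵥ : ∀ x → Δ 0ᵥ x ≡ 0ᵥ
    Δ-0ᵥ x = trans (cong (λ y → F y ⊕ F x) (⊕-identityʳ x)) (⊕-self (F x))

  collisions-Δ-APN : IsAPN n F → ∀ u → ¬ u ≡ 0ᵥ → collisions (Δ u) ≡ N * + 2
  collisions-Δ-APN apn u u≢0ᵥ = trans (∑-cong count-is-2) (∑-const {n} (+ 2))
    where
    count-is-2 : ∀ x → ∑ n (λ z → δ (Δ u z) (Δ u x)) ≡ + 2
    count-is-2 x = trans (sym (count≡∑𝟙 (λ z → Δ u z ≟ᵥ Δ u x)))
                         (cong +_ (ℕP.≤-antisym (apn u (Δ u x) u≢0ᵥ) (derivCount≥2 u x u≢0ᵥ)))

  ∑-collisions-Δ : IsAPN n F → ∑ n (λ u → collisions (Δ u)) ≡ N * (N * + 2) + (N * N - N * + 2)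
  ∑-collisions-Δ apn =
    trans (∑-outside-0ᵥ (λ u → collisions (Δ u)) (N * + 2) (collisions-Δ-APN apn))
          (cong (λ c → N * (N * + 2) + (c - N * + 2)) collisions-Δ-0ᵥ)

  ∑-∘F≡∑-preimageSize : ∀ (g : 𝔽₂^ n → ℤ) → ∑ n (λ x → g (F x)) ≡ ∑ n (λ y → g y * + preimageSize F y)
  ∑-∘F≡∑-preimageSize g = begin
    ∑ n (λ x → g (F x))                          ≡⟨ ∑-cong (λ x → ∑-δ g (F x)) ⟨
    ∑ n (λ x → ∑ n (λ y → g y * δ (F x) y))      ≡⟨ ∑-swap (λ x y → g y * δ (F x) y) ⟩
    ∑ n (λ y → ∑ n (λ x → g y * δ (F x) y))      ≡⟨ ∑-cong (λ y → ∑-*ˡ (g y) (λ x → δ (F x) y)) ⟩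
    ∑ n (λ y → g y * ∑ n (λ x → δ (F x) y))      ≡⟨ ∑-cong (λ y → cong (g y *_) (count≡∑𝟙 (λ x → F x ≟ᵥ y))) ⟨
    ∑ n (λ y → g y * + preimageSize F y)         ∎
    where open ≡-Reasoning

  collisions-distribution : HasDistribution n F → collisions F ≡ N * + 3 - + 4
  collisions-distribution (_ , #size2≡2 , size3) = begin
    ∑ n (λ x → ∑ n (λ z → δ (F z) (F x)))         ≡⟨ ∑-cong (λ x → count≡∑𝟙 (λ z → F z ≟ᵥ F x)) ⟨
    ∑ n (λ x → + p (F x))                         ≡⟨ ∑-cong (λ x → +k≡3-[k≡2] (size-2-or-3 x)) ⟩
    ∑ n (λ x → + 3 + -1ℤ * e (F x))               ≡⟨ ∑-+ (λ _ → + 3) (λ x → -1ℤ * e (F x)) ⟩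
    ∑ n (λ _ → + 3) + ∑ n (λ x → -1ℤ * e (F x))   ≡⟨ cong₂ _+_ (∑-const {n} (+ 3)) (∑-*ˡ -1ℤ (λ x → e (F x))) ⟩
    N * + 3 + -1ℤ * ∑ n (λ x → e (F x))           ≡⟨ cong (λ s → N * + 3 + -1ℤ * s) ∑e∘F ⟩
    N * + 3 - + 4                                 ∎
    where
    open ≡-Reasoning
    p : 𝔽₂^ n → ℕ
    p = preimageSize F
    e : 𝔽₂^ n → ℤ
    e y = 𝟙 (p y ℕP.≟ 2)
    +k≡3-[k≡2] : ∀ {k} → k ≡ 2 ⊎ k ≡ 3 → + k ≡ + 3 + -1ℤ * 𝟙 (k ℕP.≟ 2)
    +k≡3-[k≡2] (inj₁ refl) = refl
    +k≡3-[k≡2] (inj₂ refl) = refl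
    [k≡2]*k≡2*[k≡2] : ∀ k → 𝟙 (k ℕP.≟ 2) * + k ≡ + 2 * 𝟙 (k ℕP.≟ 2)
    [k≡2]*k≡2*[k≡2] k with k ℕP.≟ 2
    ... | yes refl = refl
    ... | no _     = refl
    p∘F≥1 : ∀ x → 1 ℕ.≤ p (F x)
    p∘F≥1 x = ℤP.drop‿+<+ (subst₂ _<_ (∑-vanish {n} {λ _ → + 0} (λ _ → refl)) (sym (count≡∑𝟙 (λ z → F z ≟ᵥ F x)))
      (∑-mono-< {g = λ _ → + 0} (λ z → δ-nonneg (F z) (F x)) x (subst (+ 0 <_) (sym (δ-refl (F x))) (ℤP.positive⁻¹ _))))
    size-2-or-3 : ∀ x → p (F x) ≡ 2 ⊎ p (F x) ≡ 3
    size-2-or-3 x with p (F x) ℕP.≟ 2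
    ... | yes p≡2 = inj₁ p≡2
    ... | no p≢2  = inj₂ (size3 (F x) (p∘F≥1 x) p≢2)
    ∑e : ∑ n e ≡ + 2
    ∑e = begin
      ∑ n e                                                       ≡⟨ count≡∑𝟙 (λ y → p y ℕP.≟ 2) ⟨
      + length (filter (λ y → p y ℕP.≟ 2) (allVecs n))
        ≡⟨ cong (λ ys → + length ys) (filter-filter _ _ (λ p≡2 → subst (1 ℕ.≤_) (sym p≡2) (ℕ.s≤s ℕ.z≤n)) (allVecs n)) ⟨
      + length (filter (λ y → p y ℕP.≟ 2) (image F))              ≡⟨ cong +_ #size2≡2 ⟩
      + 2                                                         ∎
    ∑e∘F : ∑ n (λ x → e (F x)) ≡ + 4
    ∑e∘F = begin
      ∑ n (λ x → e (F x))                   ≡⟨ ∑-∘F≡∑-preimageSize e ⟩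
      ∑ n (λ y → e y * + p y)               ≡⟨ ∑-cong (λ y → [k≡2]*k≡2*[k≡2] (p y)) ⟩
      ∑ n (λ y → + 2 * e y)                 ≡⟨ ∑-*ˡ (+ 2) e ⟩
      + 2 * ∑ n e                           ≡⟨ cong (+ 2 *_) ∑e ⟩
      + 4                                   ∎

  ∑-excess : IsAPN n F → HasDistribution n F → ∑ n (λ b → excess (W b)) ≡ + 2 * (N * N * N)
  ∑-excess apn dist = begin
    ∑ n (λ b → excess (W b))
      ≡⟨ ∑-cong (λ b → cong (_+_ (M₄ b)) (ℤP.neg-distribˡ-* (N * N) (M₂ b))) ⟩
    ∑ n (λ b → M₄ b + - (N * N) * M₂ b)
      ≡⟨ ∑-+ M₄ (λ b → - (N * N) * M₂ b) ⟩
    ∑ n M₄ + ∑ n (λ b → - (N * N) * M₂ b)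
      ≡⟨ cong (_+_ (∑ n M₄)) (∑-*ˡ (- (N * N)) M₂) ⟩
    ∑ n M₄ + - (N * N) * ∑ n M₂
      ≡⟨ cong₂ (λ s t → s + - (N * N) * t) fourth-moment second-moment-at-0ᵥ ⟩
    N * (N * ∑ n (λ u → collisions (Δ u))) + - (N * N) * (N * collisions F)
      ≡⟨ cong₂ (λ s t → N * (N * s) + - (N * N) * (N * t)) (∑-collisions-Δ apn) (collisions-distribution dist) ⟩
    N * (N * (N * (N * + 2) + (N * N - N * + 2))) + - (N * N) * (N * (N * + 3 - + 4))
      ≡⟨ arithmetic N ⟩
    + 2 * (N * N * N) ∎
    where
    open ≡-Reasoning
    M₄ M₂ : 𝔽₂^ n → ℤ
    M₄ b = ∑ n (λ a → (W b a * W b a) * (W b a * W b a))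
    M₂ b = W b 0ᵥ * W b 0ᵥ
    arithmetic : ∀ N → N * (N * (N * (N * + 2) + (N * N - N * + 2))) + - (N * N) * (N * (N * + 3 - + 4))
                         ≡ + 2 * (N * N * N)
    arithmetic = solve-∀

  W-plateau : IsPlateauedFn n F → ∀ b → ∃ λ m → Plateau ((+ 4) ^ m) (W b)
  -- IsPlateauedFn says nothing about b = 0ᵥ; there W 0ᵥ = 2ⁿ δ₀ is computed directly.
  W-plateau plateaued b with b ≟ᵥ 0ᵥ
  ... | yes refl = n , W₀-plateau
    where
    W₀≡Nδ : ∀ a → W 0ᵥ a ≡ N * δ a 0ᵥ
    W₀≡Nδ a = trans (W≡fourier 0ᵥ a)
      (trans (∑-cong (λ x → trans (cong (χ a x *_) (χ-0ᵥ (F x))) (ℤP.*-identityʳ (χ a x)))) (∑-χ a))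
    W₀-plateau : Plateau ((+ 4) ^ n) (W 0ᵥ)
    W₀-plateau a with 𝟙≡0⊎𝟙≡1 (a ≟ᵥ 0ᵥ)
    ... | inj₁ δ≡0 = inj₁ (cong (λ w → w * w) (trans (W₀≡Nδ a) (trans (cong (N *_) δ≡0) (ℤP.*-zeroʳ N))))
    ... | inj₂ δ≡1 = inj₂ (trans (cong (λ w → w * w) (trans (W₀≡Nδ a) (trans (cong (N *_) δ≡1) (ℤP.*-identityʳ N))))
                                 (sym (4^≡#𝔽₂^*#𝔽₂^ n)))
  W-plateau plateaued b | no b≢0ᵥ with plateaued b b≢0ᵥ
  ... | s , Fᵇ-plateaued = (n ℕ.+ s) ℕ./ 2 , plateaued⇒Plateau (component F b) Fᵇ-plateaued

theorem6p7 : (n : ℕ) → n % 2 ≡ 0 → (F : 𝔽₂^ n → 𝔽₂^ n) →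
    IsPlateauedFn n F → IsAPN n F → ¬ HasDistribution n F
theorem6p7 n n-even F plateaued apn dist =
  2P-neither-0-nor-≥4P N³>0 (subst (λ s → s ≡ + 0 ⊎ + 4 * N³ ≤ s) (∑-excess F apn dist) ∑-excess-gap)
  where
  N³ : ℤ
  N³ = #𝔽₂^ n * #𝔽₂^ n * #𝔽₂^ n
  N³>0 : + 0 < N³
  N³>0 = *-pos (*-pos (#𝔽₂^-pos n) (#𝔽₂^-pos n)) (#𝔽₂^-pos n)
  excess-gap : ∀ b → excess (W F b) ≡ + 0 ⊎ + 4 * N³ ≤ excess (W F b)
  excess-gap b with even⇒#𝔽₂^≡4^ n n-even | W-plateau F plateaued b
  ... | k , N≡4^k | m , plateau = excess-zero-or-≥ k m (W F b) N≡4^k plateau (parseval-W F b)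
  ∑-excess-gap : ∑ n (λ b → excess (W F b)) ≡ + 0 ⊎ + 4 * N³ ≤ ∑ n (λ b → excess (W F b))
  ∑-excess-gap = ∑-zero-or-≥ (λ b → excess (W F b)) (+ 4 * N³) (ℤP.<⇒≤ (*-pos {+ 4} (ℤP.positive⁻¹ _) N³>0)) excess-gap
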